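{- For any graph $G$ with at least one edge, $\chi_\rho''(G) \geq \Delta(G)+2$, where $\Delta(G)$ is the maximum degree of $G$.
   Context: All graphs are simple, finite and undirected. The total graph $T(G)$ of a graph $G$ has vertex set $V(G)\cup E(G)$, where two elements are adjacent if they are adjacent vertices of $G$, incident edges of $G$ (sharing an endpoint), or a vertex and an edge of $G$ having that vertex as an endpoint. A packing total coloring of $G$ is a map $c:V(G)\cup E(G)\to\{1,2,\dots\}$ such that for any two distinct elements $A,B\in V(G)\cup E(G)$ with $c(A)=c(B)=i$, the distance between $A$ and $B$ in $T(G)$ is greater than $i$. The packing total chromatic number $\chi_\rho''(G)$ is the smallest $k$ such that $G$ has a packing total coloring with colors from $\{1,\dots,k\}$. -}

module Defs where

open import Data.Nat using (ℕ; zero; suc; _≤_; _⊔_)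
open import Data.Fin using (Fin) renaming (_<_ to _<ᶠ_)
open import Data.Bool using (Bool; true; false)
open import Data.List using (List; length; filterᵇ; allFin; map; foldr)
open import Data.Product using (Σ; _×_; _,_; proj₁; proj₂; ∃-syntax)
open import Data.Sum using (_⊎_; inj₁; inj₂)
open import Relation.Binary.PropositionalEquality using (_≡_; _≢_)
open import Relation.Nullary using (¬_)

record SimpleGraph (n : ℕ) : Set where
  field
    adj    : Fin n → Fin n → Bool
    sym    : ∀ u v → adj u v ≡ adj v u
    irrefl : ∀ v → adj v v ≡ false

module _ {n : ℕ} (G : SimpleGraph n) where
  open SimpleGraph G

  degree : Fin n → ℕ
  degree v = length (filterᵇ (adj v) (allFin n))

  maxDegree : ℕ
  maxDegree = foldr _⊔_ 0 (map degree (allFin n))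

  HasEdge : Set
  HasEdge = ∃[ u ] ∃[ v ] adj u v ≡ true

  Edge : Set
  Edge = Σ (Fin n × Fin n) (λ p → (proj₁ p <ᶠ proj₂ p) × adj (proj₁ p) (proj₂ p) ≡ true)

  endpoint₁ endpoint₂ : Edge → Fin n
  endpoint₁ e = proj₁ (proj₁ e)
  endpoint₂ e = proj₂ (proj₁ e)

  IncidentTo : Fin n → Edge → Set
  IncidentTo w e = (w ≡ endpoint₁ e) ⊎ (w ≡ endpoint₂ e)

  -- vertices of the total graph T(G)
  Elem : Set
  Elem = Fin n ⊎ Edge

  TAdj : Elem → Elem → Set
  TAdj (inj₁ u) (inj₁ v) = adj u v ≡ true
  TAdj (inj₁ w) (inj₂ e) = IncidentTo w e
  TAdj (inj₂ e) (inj₁ w) = IncidentTo w e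
  TAdj (inj₂ e) (inj₂ f) = (e ≢ f) × (∃[ w ] (IncidentTo w e × IncidentTo w f))

  data Within : ℕ → Elem → Elem → Set where
    here : ∀ {i A} → Within i A A
    step : ∀ {i A B C} → TAdj A C → Within i C B → Within (suc i) A B

  record PackingTotalColoring (k : ℕ) : Set where
    field
      colour  : Elem → ℕ
      range   : ∀ A → (1 ≤ colour A) × (colour A ≤ k)
      packing : ∀ A B → A ≢ B → colour A ≡ colour B → ¬ Within (colour A) A B

-- At a vertex v of maximum degree Δ ≥ 1, the vertex v and its Δ incident edges are
-- pairwise adjacent in T(G), so they carry Δ + 1 distinct colours. Any neighbour u of v
-- is at distance at most 2 from all of them, so u can only repeat one of their colours
-- if that colour is 1 and u is not adjacent to its bearer. At most one of them has
-- colour 1; choosing u to be an endpoint of that element (or any neighbour if there is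
-- none) rules this out, and u needs a (Δ + 2)-th colour.
module Submission where

open import Defs
open import Data.Nat using (ℕ; _≤_; _+_)
open import Data.Nat using (zero; suc; z≤n; s≤s; s≤s⁻¹; _<_; _∸_; _≟_; _≤?_)
open import Data.Nat.Properties
  using (≤-trans; ≤-antisym; ≰⇒>; ⊔-lub; +-comm; m≤m+n; m+n≤o⇒m≤o∸n; m≤o∸n⇒m+n≤o)
open import Data.Fin using (Fin; zero; suc; fromℕ<)
open import Data.Fin.Properties
  using (<-cmp; any?; injective⇒≤; fromℕ<-injective; suc-injective) renaming (_≟_ to _≟ᶠ_)
open import Data.Bool using (true)
open import Data.Bool.Properties using (T-≡)
open import Data.List using (List; _∷_; length; filterᵇ; allFin; lookup)
open import Data.List.Membership.Propositional using (_∈_)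
open import Data.List.Membership.Propositional.Properties using (∈-filter⁻; ∈-filter⁺; ∈-lookup; ∈-allFin)
open import Data.List.Properties using (foldr-preservesᵇ)
open import Data.List.Relation.Unary.Any using (here; there)
open import Data.List.Relation.Unary.All using () renaming (lookup to All-lookup)
open import Data.List.Relation.Unary.All.Properties using (map⁺; tabulate⁺)
open import Data.List.Relation.Unary.AllPairs using (_∷_)
open import Data.List.Relation.Unary.Unique.Propositional using (Unique)
open import Data.List.Relation.Unary.Unique.Propositional.Properties using (filter⁺; allFin⁺)
open import Data.Product using (_,_; proj₁; proj₂)
open import Data.Sum using (_⊎_; inj₁; inj₂; swap)
open import Data.Empty using (⊥-elim)
open import Function using (_∘_; Injective; Equivalence)
open import Relation.Binary using (tri<; tri≈; tri>)
open import Relation.Binary.PropositionalEquality using (_≡_; _≢_; refl; sym; trans; cong; subst)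
open import Relation.Nullary using (¬_; yes; no)
open import Relation.Nullary.Decidable using (T?)

lookup-injective : ∀ {a} {A : Set a} {xs : List A} → Unique xs → Injective _≡_ _≡_ (lookup xs)
lookup-injective {xs = _ ∷ _}  (_ ∷ _)       {zero}  {zero}  _  = refl
lookup-injective {xs = _ ∷ _}  (x∉xs ∷ _)    {zero}  {suc j} eq = ⊥-elim (All-lookup x∉xs (∈-lookup j) eq)
lookup-injective {xs = _ ∷ _}  (x∉xs ∷ _)    {suc i} {zero}  eq = ⊥-elim (All-lookup x∉xs (∈-lookup i) (sym eq))
lookup-injective {xs = _ ∷ xs} (_ ∷ uniq-xs) {suc i} {suc j} eq = cong suc (lookup-injective uniq-xs eq)

∈⇒0<length : ∀ {a} {A : Set a} {x : A} {xs : List A} → x ∈ xs → 0 < length xs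
∈⇒0<length (here _)  = s≤s z≤n
∈⇒0<length (there _) = s≤s z≤n

predFin : ∀ {c k} → 0 < c → c ≤ k → Fin k
predFin {suc c} _ c<k = fromℕ< c<k

predFin-injective : ∀ {c d k} (0<c : 0 < c) (c≤k : c ≤ k) (0<d : 0 < d) (d≤k : d ≤ k) →
                    predFin 0<c c≤k ≡ predFin 0<d d≤k → c ≡ d
predFin-injective {suc c} {suc d} _ _ _ _ eq = cong suc (fromℕ<-injective c d _ _ eq)

module _ {n : ℕ} (G : SimpleGraph n) where
  open SimpleGraph G renaming (sym to adj-sym)

  TAdj-irrefl : ∀ {A} → ¬ TAdj G A A
  TAdj-irrefl {inj₁ v} vv with trans (sym vv) (irrefl v)
  ... | ()
  TAdj-irrefl {inj₂ e} (e≢e , _) = e≢e refl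

  TAdj⇒≢ : ∀ {A B} → TAdj G A B → A ≢ B
  TAdj⇒≢ t refl = TAdj-irrefl t

  adj⇒≢ : ∀ {v w} → adj v w ≡ true → v ≢ w
  adj⇒≢ vw refl = TAdj-irrefl {inj₁ _} vw

  within-mono : ∀ {i j A B} → Within G i A B → i ≤ j → Within G j A B
  within-mono here       _         = here
  within-mono (step t w) (s≤s i≤j) = step t (within-mono w i≤j)

  edge : ∀ {v w} → adj v w ≡ true → Edge G
  edge {v} {w} vw with <-cmp v w
  ... | tri< v<w _ _ = (v , w) , v<w , vw
  ... | tri≈ _ v≡w _ = ⊥-elim (adj⇒≢ vw v≡w)
  ... | tri> _ _ w<v = (w , v) , w<v , trans (adj-sym w v) vw

  incident-edge : ∀ {v w x} (vw : adj v w ≡ true) → x ≡ v ⊎ x ≡ w → IncidentTo G x (edge vw)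
  incident-edge {v} {w} vw x∈vw with <-cmp v w
  ... | tri< _ _ _   = x∈vw
  ... | tri≈ _ v≡w _ = ⊥-elim (adj⇒≢ vw v≡w)
  ... | tri> _ _ _   = swap x∈vw

  incident-edge⁻ : ∀ {v w x} (vw : adj v w ≡ true) → IncidentTo G x (edge vw) → x ≡ v ⊎ x ≡ w
  incident-edge⁻ {v} {w} vw x∈e with <-cmp v w
  ... | tri< _ _ _   = x∈e
  ... | tri≈ _ v≡w _ = ⊥-elim (adj⇒≢ vw v≡w)
  ... | tri> _ _ _   = swap x∈e

  neighbours : Fin n → List (Fin n)
  neighbours v = filterᵇ (adj v) (allFin n)

  neighbour : ∀ v → Fin (degree G v) → Fin n
  neighbour v = lookup (neighbours v)

  neighbour-adj : ∀ v i → adj v (neighbour v i) ≡ true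
  neighbour-adj v i =
    Equivalence.to T-≡ (proj₂ (∈-filter⁻ (T? ∘ adj v) {xs = allFin n} (∈-lookup i)))

  neighbour-injective : ∀ v → Injective _≡_ _≡_ (neighbour v)
  neighbour-injective v = lookup-injective (filter⁺ (T? ∘ adj v) (allFin⁺ n))

  adj⇒0<degree : ∀ {v w} → adj v w ≡ true → 0 < degree G v
  adj⇒0<degree {v} {w} vw =
    ∈⇒0<length (∈-filter⁺ (T? ∘ adj v) (∈-allFin w) (Equivalence.from T-≡ vw))

  maxDegree-lub : ∀ {m} → (∀ v → degree G v ≤ m) → maxDegree G ≤ m
  maxDegree-lub {m} bound = foldr-preservesᵇ {P = _≤ m} ⊔-lub z≤n (map⁺ (tabulate⁺ bound))

  spoke : ∀ v → Fin (degree G v) → Edge G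
  spoke v i = edge (neighbour-adj v i)

  spoke-injective : ∀ v → Injective _≡_ _≡_ (spoke v)
  spoke-injective v {i} {j} eq
    with incident-edge⁻ (neighbour-adj v j) (subst (IncidentTo G (neighbour v i)) eq vᵢ∈spoke)
    where vᵢ∈spoke = incident-edge (neighbour-adj v i) (inj₂ refl)
  ... | inj₁ vᵢ≡v  = ⊥-elim (adj⇒≢ (neighbour-adj v i) (sym vᵢ≡v))
  ... | inj₂ vᵢ≡vⱼ = neighbour-injective v vᵢ≡vⱼ

  star : ∀ v → Fin (suc (degree G v)) → Elem G
  star v zero    = inj₁ v
  star v (suc i) = inj₂ (spoke v i)

  star-clique : ∀ v {i j} → i ≢ j → TAdj G (star v i) (star v j)
  star-clique v {zero}  {zero}  i≢j = ⊥-elim (i≢j refl)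
  star-clique v {zero}  {suc j} _   = incident-edge (neighbour-adj v j) (inj₁ refl)
  star-clique v {suc i} {zero}  _   = incident-edge (neighbour-adj v i) (inj₁ refl)
  star-clique v {suc i} {suc j} i≢j =
    (i≢j ∘ cong suc ∘ spoke-injective v) , v ,
    incident-edge (neighbour-adj v i) (inj₁ refl) , incident-edge (neighbour-adj v j) (inj₁ refl)

  star-near : ∀ {v u} → adj v u ≡ true → ∀ j → Within G 2 (inj₁ u) (star v j)
  star-near {v} {u} vu zero    = step (trans (adj-sym u v) vu) here
  star-near {v} {u} vu (suc j) =
    step (trans (adj-sym u v) vu) (step (incident-edge (neighbour-adj v j) (inj₁ refl)) here)

  star-∌ : ∀ {v u} → adj v u ≡ true → ∀ j → inj₁ u ≢ star v j
  star-∌ vu zero refl = adj⇒≢ vu refl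
  star-∌ vu (suc j) ()

module _ {n : ℕ} {G : SimpleGraph n} {k : ℕ} (c : PackingTotalColoring G k) where
  open PackingTotalColoring c
  open SimpleGraph G using (adj) renaming (sym to adj-sym)

  distinct-colours⇒≤ : ∀ {m} (S : Fin m → Elem G) →
                       (∀ {i j} → i ≢ j → colour (S i) ≢ colour (S j)) → m ≤ k
  distinct-colours⇒≤ S distinct = injective⇒≤ slot-injective
    where
      slot : Fin _ → Fin k
      slot i = predFin (proj₁ (range (S i))) (proj₂ (range (S i)))

      slot-injective : Injective _≡_ _≡_ slot
      slot-injective {i} {j} eq with i ≟ᶠ j
      ... | yes i≡j = i≡j
      ... | no  i≢j = ⊥-elim (distinct i≢j (predFin-injective _ _ _ _ eq))

  adjacent⇒colour≢ : ∀ {A B} → TAdj G A B → colour A ≢ colour B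
  adjacent⇒colour≢ {A} {B} t eq =
    packing A B (TAdj⇒≢ G t) eq (within-mono G (step t here) (proj₁ (range A)))

  -- Colour 1 is the only colour that may repeat at distance 2.
  near⇒colour≢ : ∀ {A B} → A ≢ B → Within G 2 A B → (colour B ≡ 1 → TAdj G A B) →
                 colour A ≢ colour B
  near⇒colour≢ {A} {B} A≢B w colour1⇒adj eq with colour A ≤? 1
  ... | yes ≤1 =
    adjacent⇒colour≢ (colour1⇒adj (trans (sym eq) (≤-antisym ≤1 (proj₁ (range A))))) eq
  ... | no  ≰1 = packing A B A≢B eq (within-mono G w (≰⇒> ≰1))

  clique+near⇒≤ : ∀ {m} (S : Fin m → Elem G) (X : Elem G) →
                  (∀ {i j} → i ≢ j → TAdj G (S i) (S j)) →
                  (∀ i → X ≢ S i) → (∀ i → Within G 2 X (S i)) →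
                  (∀ i → colour (S i) ≡ 1 → TAdj G X (S i)) → suc m ≤ k
  clique+near⇒≤ S X clique X∉S near colour1⇒adj = distinct-colours⇒≤ extended distinct
    where
      extended : Fin (suc _) → Elem G
      extended zero    = X
      extended (suc i) = S i

      distinct : ∀ {i j} → i ≢ j → colour (extended i) ≢ colour (extended j)
      distinct {zero}  {zero}  i≢j = ⊥-elim (i≢j refl)
      distinct {zero}  {suc j} _   = near⇒colour≢ (X∉S j) (near j) (colour1⇒adj j)
      distinct {suc i} {zero}  _   = near⇒colour≢ (X∉S i) (near i) (colour1⇒adj i) ∘ sym
      distinct {suc i} {suc j} i≢j = adjacent⇒colour≢ (clique (i≢j ∘ cong suc))

  star+neighbour⇒≤ : ∀ {v u} → adj v u ≡ true →
                     (∀ j → colour (inj₂ (spoke G v j)) ≡ 1 → IncidentTo G u (spoke G v j)) →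
                     2 + degree G v ≤ k
  star+neighbour⇒≤ {v} {u} vu colour1⇒incident =
    clique+near⇒≤ (star G v) (inj₁ u) (star-clique G v) (star-∌ G vu) (star-near G vu) colour1⇒adj
    where
      colour1⇒adj : ∀ j → colour (star G v j) ≡ 1 → TAdj G (inj₁ u) (star G v j)
      colour1⇒adj zero    _ = trans (adj-sym u v) vu
      colour1⇒adj (suc j)   = colour1⇒incident j

  -- If some spoke has colour 1 it is the only one, and its far endpoint serves as u.
  2+degree≤k : ∀ v → 0 < degree G v → 2 + degree G v ≤ k
  2+degree≤k v 0<deg with any? (λ i → colour (inj₂ (spoke G v i)) ≟ 1)
  ... | no  none =
    star+neighbour⇒≤ (neighbour-adj G v (fromℕ< 0<deg)) (λ j c≡1 → ⊥-elim (none (j , c≡1)))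
  ... | yes (i , cᵢ≡1) = star+neighbour⇒≤ (neighbour-adj G v i) onlySpoke
    where
      onlySpoke : ∀ j → colour (inj₂ (spoke G v j)) ≡ 1 →
                  IncidentTo G (neighbour G v i) (spoke G v j)
      onlySpoke j cⱼ≡1 with i ≟ᶠ j
      ... | yes refl = incident-edge G (neighbour-adj G v i) (inj₂ refl)
      ... | no  i≢j  = ⊥-elim (adjacent⇒colour≢ (star-clique G v (i≢j ∘ suc-injective))
                                                  (trans cᵢ≡1 (sym cⱼ≡1)))

  degree≤k∸2 : ∀ v → degree G v ≤ k ∸ 2
  degree≤k∸2 v with 1 ≤? degree G v
  ... | yes 0<deg = m+n≤o⇒m≤o∸n _ (subst (_≤ k) (+-comm 2 _) (2+degree≤k v 0<deg))
  ... | no  0≮deg = ≤-trans (s≤s⁻¹ (≰⇒> 0≮deg)) z≤n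

proposition2p2 : ∀ {n : ℕ} (G : SimpleGraph n) → HasEdge G →
    ∀ (k : ℕ) → PackingTotalColoring G k → maxDegree G + 2 ≤ k
proposition2p2 G (a , b , ab) k c =
  m≤o∸n⇒m+n≤o (maxDegree G) 2≤k (maxDegree-lub G (degree≤k∸2 c))
  where
    2≤k : 2 ≤ k
    2≤k = ≤-trans (m≤m+n 2 _) (2+degree≤k c a (adj⇒0<degree G ab))
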